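{- Let $q\geq 0$ be an integer and let $p,r$ be integers with $p>q+1$, $r>q+1$ and $p+r$ even. Then \begin{align*} \zeta_{H^{(p,q+1)}}(r)+\zeta_{H^{(r,q+1)}}(p) &=\zeta(p+r)+\frac{2}{q!}\sum_{\substack{m=0\\ m\text{ odd}}}^{q}\sum_{k=0}^{m}(-1)^{k}\genfrac{[}{]}{0pt}{}{q+1}{m+1}\binom{m}{k}\zeta_{H^{(p-k)}}(r+k-m)\\ &\quad+\frac{1}{q!}\sum_{m=0}^{q}\sum_{k=0}^{m}(-1)^{m+k}\genfrac{[}{]}{0pt}{}{q+1}{m+1}\binom{m}{k}\zeta(p-k)\,\zeta(r+k-m). \end{align*}
   Context: $\zeta$ is the Riemann zeta function. For $p\in\mathbb{Z}$ and $n\geq1$, $H_n^{(p)}=\sum_{j=1}^{n}j^{ -p}$. The generalized hyperharmonic numbers are defined by $H_n^{(p,0)}=1/n^{p}$ and $H_n^{(p,r)}=\sum_{k=1}^{n}H_k^{(p,r-1)}$ for $r\geq1$. Euler sums: $\zeta_{H^{(p)}}(s)=\sum_{n=1}^{\infty}H_n^{(p)}/n^{s}$ and $\zeta_{H^{(p,q)}}(s)=\sum_{n=1}^{\infty}H_n^{(p,q)}/n^{s}$. $\genfrac{[}{]}{0pt}{}{n}{k}$ denotes the unsigned Stirling number of the first kind, defined by $x(x+1)\cdots(x+n-1)=\sum_{k=0}^{n}\genfrac{[}{]}{0pt}{}{n}{k}x^{k}$. -}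

module Defs where

open import Data.Nat as ℕ using (ℕ; zero; suc; _∸_)
open import Data.Nat.Combinatorics using (_C_)
open import Data.Nat.Base using (_!)
open import Data.Nat.Properties using (_!≢0)
open import Data.Bool using (Bool; true; false; not; if_then_else_)
open import Data.Integer using (ℤ; +_)
open import Data.Rational using (ℚ; 0ℚ; 1ℚ; _+_; _*_; _-_; -_; _/_; ∣_∣; _<_; _≤_)
open import Data.Product using (∃-syntax)

fromℕ : ℕ → ℚ
fromℕ n = (+ n) / 1

-- invPow n s = 1 / n^s for n ≥ 1 (the value at n = 0 is never used; set to 0)
invPow : ℕ → ℕ → ℚ
invPow zero    s       = 0ℚ
invPow (suc j) zero    = 1ℚ
invPow (suc j) (suc s) = invPow (suc j) s * ((+ 1) / suc j)

-- sumTo f n = Σ_{k=1}^{n} f k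
sumTo : (ℕ → ℚ) → ℕ → ℚ
sumTo f zero    = 0ℚ
sumTo f (suc n) = sumTo f n + f (suc n)

-- sumUpTo f n = Σ_{m=0}^{n} f m
sumUpTo : (ℕ → ℚ) → ℕ → ℚ
sumUpTo f zero    = f zero
sumUpTo f (suc n) = sumUpTo f n + f (suc n)

sign : ℕ → ℚ
sign zero    = 1ℚ
sign (suc k) = - sign k

isOdd : ℕ → Bool
isOdd zero    = false
isOdd (suc n) = not (isOdd n)

-- unsigned Stirling numbers of the first kind:
-- x(x+1)...(x+n-1) = Σ_k [n,k] x^k, equivalently [n+1,k+1] = n [n,k+1] + [n,k]
stirling1 : ℕ → ℕ → ℕ
stirling1 zero    zero    = 1
stirling1 zero    (suc k) = 0
stirling1 (suc n) zero    = 0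
stirling1 (suc n) (suc k) = n ℕ.* stirling1 n (suc k) ℕ.+ stirling1 n k

harm : ℕ → ℕ → ℚ
harm p n = sumTo (λ j → invPow j p) n

hyper : ℕ → ℕ → ℕ → ℚ
hyper p zero    n = invPow n p
hyper p (suc r) n = sumTo (hyper p r) n

-- N-th partial sums of ζ(s), ζ_{H^{(p)}}(s), ζ_{H^{(p,q)}}(s)
zetaN : ℕ → ℕ → ℚ
zetaN s N = sumTo (λ n → invPow n s) N

eulerN : ℕ → ℕ → ℕ → ℚ
eulerN p s N = sumTo (λ n → harm p n * invPow n s) N

hypEulerN : ℕ → ℕ → ℕ → ℕ → ℚ
hypEulerN p q s N = sumTo (λ n → hyper p q n * invPow n s) N

ConvergesTo : (ℕ → ℚ) → ℚ → Set
ConvergesTo a L = ∀ (ε : ℚ) → 0ℚ < ε → ∃[ N ] (∀ n → N ℕ.≤ n → ∣ a n - L ∣ < ε)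

lhsN : ℕ → ℕ → ℕ → ℕ → ℚ
lhsN q p r N = hypEulerN p (suc q) r N + hypEulerN r (suc q) p N

-- N-th truncation of the right-hand side (every series truncated at N)
rhsN : ℕ → ℕ → ℕ → ℕ → ℚ
rhsN q p r N =
  zetaN (p ℕ.+ r) N
  + ((+ 2) / (q !)) {{q !≢0}} * sumUpTo (λ m → if isOdd m then
        sumUpTo (λ k → sign k * fromℕ (stirling1 (suc q) (suc m)) * fromℕ (m C k)
                       * eulerN (p ∸ k) ((r ℕ.+ k) ∸ m) N) m
      else 0ℚ) q
  + ((+ 1) / (q !)) {{q !≢0}} * sumUpTo (λ m →
        sumUpTo (λ k → sign (m ℕ.+ k) * fromℕ (stirling1 (suc q) (suc m)) * fromℕ (m C k)
                       * (zetaN (p ∸ k) N * zetaN ((r ℕ.+ k) ∸ m) N)) m) q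

{-# OPTIONS --safe #-}
-- The identity already holds exactly for the truncations at every N.
-- Writing q! H_n^(p,q+1) = Σ_{k ≤ n} (n-k+1)(n-k+2)⋯(n-k+q) / k^p, expanding the rising
-- factorial in Stirling numbers, x(x+1)⋯(x+q) = Σ_m [q+1,m+1] x^(m+1), and (n-k)^m binomially
-- turns q! ζ_{H^(p,q+1)}(r) into Σ_{m ≤ q} Σ_{k ≤ m} (-1)^k [q+1,m+1] C(m,k) ζ_{H^(p-k)}(r+k-m).
-- For the same sum with p and r exchanged, reverse k ↦ m - k and apply the reflection formula
-- ζ_{H^(a)}(b) + ζ_{H^(b)}(a) = ζ(a) ζ(b) + ζ(a+b). Then (-1)^k - (-1)^(m+k) doubles the odd rows
-- and kills the even ones, and Σ_k (-1)^k C(m,k) = [m = 0] collapses the ζ(p+r-m) terms to q! ζ(p+r).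

module Submission where

open import Defs
open import Data.Nat using (ℕ; suc; _+_; _<_)
open import Data.Nat.Divisibility using (_∣_)
open import Data.Rational using (0ℚ; _-_)

open import Algebra.Bundles using (CommutativeRing; CommutativeSemiring)
open import Data.Bool using (true; false; if_then_else_)
open import Data.Fin using (toℕ)
open import Data.Integer using (+_)
open import Data.Integer.Solver using (module +-*-Solver)
open import Data.Nat as ℕ using (zero; _≤_; z≤n; _∸_; _!)
import Data.Nat.Properties as ℕ
open import Data.Nat.Properties using (_!≢0)
open import Data.Nat.Combinatorics using (_C_; nCk≡nC[n∸k])
open import Data.Product using (_,_)
open import Data.Rational using (ℚ; 1ℚ; -_; _/_; ∣_∣; toℚᵘ)
  renaming (_+_ to _+ℚ_; _*_ to _*ℚ_; _<_ to _<ℚ_)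
import Data.Rational.Properties as ℚ
open import Data.Rational.Properties using (toℚᵘ-injective; toℚᵘ-fromℚᵘ; toℚᵘ-homo-+; toℚᵘ-homo-*)
open import Data.Rational.Solver using (module +-*-Solver)
import Data.Rational.Unnormalised as ℚᵘ
import Data.Rational.Unnormalised.Properties as ℚᵘ
open import Relation.Binary.PropositionalEquality
open ≡-Reasoning

open Data.Rational.Solver.+-*-Solver
module ℤ = Data.Integer.Solver.+-*-Solver

ℚ-commutativeSemiring : CommutativeSemiring _ _
ℚ-commutativeSemiring = CommutativeRing.commutativeSemiring ℚ.+-*-commutativeRing

open CommutativeSemiring ℚ-commutativeSemiring using (semiring; +-monoid; +-commutativeSemigroup)
open import Algebra.Properties.CommutativeSemigroup +-commutativeSemigroup using (interchange)
open import Algebra.Properties.Semiring.Mult semiring using (_×_; ×-homo-+; ×1-homo-*; ×-assoc-*)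
open import Algebra.Properties.Semiring.Exp semiring using (_^_; ^-homo-*)
open import Algebra.Properties.CommutativeSemiring.Exp ℚ-commutativeSemiring using (^-distrib-*)
open import Algebra.Properties.Monoid.Sum +-monoid using (sum)
import Algebra.Properties.CommutativeSemiring.Binomial ℚ-commutativeSemiring as Binomial

-- (+ n) / 1 is normalised by a gcd that does not reduce on a variable n, so the arithmetic
-- of fromℕ is done in the unnormalised rationals.
toℚᵘ-fromℕ : ∀ n → toℚᵘ (fromℕ n) ℚᵘ.≃ ℚᵘ.mkℚᵘ (+ n) 0
toℚᵘ-fromℕ n = toℚᵘ-fromℚᵘ (ℚᵘ.mkℚᵘ (+ n) 0)

fromℕ-suc : ∀ n → fromℕ (suc n) ≡ 1ℚ +ℚ fromℕ n
fromℕ-suc n = toℚᵘ-injective (ℚᵘ.≃-trans (toℚᵘ-fromℕ (suc n)) (ℚᵘ.≃-trans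
  (ℚᵘ.*≡* (ℤ.solve 1 (λ x → (ℤ.con (+ 1) ℤ.:+ x) ℤ.:* (ℤ.con (+ 1) ℤ.:* ℤ.con (+ 1))
                         ℤ.:= (ℤ.con (+ 1) ℤ.:* ℤ.con (+ 1) ℤ.:+ x ℤ.:* ℤ.con (+ 1)) ℤ.:* ℤ.con (+ 1)) refl (+ n)))
  (ℚᵘ.≃-sym (ℚᵘ.≃-trans (toℚᵘ-homo-+ 1ℚ (fromℕ n)) (ℚᵘ.+-cong (toℚᵘ-fromℕ 1) (toℚᵘ-fromℕ n))))))

fromℕ-*-/ : ∀ n .{{_ : ℕ.NonZero n}} a → fromℕ n *ℚ ((+ a) / n) ≡ fromℕ a
fromℕ-*-/ (suc n) a = toℚᵘ-injective (ℚᵘ.≃-trans (toℚᵘ-homo-* (fromℕ (suc n)) ((+ a) / suc n)) (ℚᵘ.≃-trans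
  (ℚᵘ.*-cong (toℚᵘ-fromℕ (suc n)) (toℚᵘ-fromℚᵘ (ℚᵘ.mkℚᵘ (+ a) n)))
  (ℚᵘ.≃-trans (ℚᵘ.*≡* (ℤ.solve 2 (λ x y → (x ℤ.:* y) ℤ.:* ℤ.con (+ 1) ℤ.:= y ℤ.:* (ℤ.con (+ 1) ℤ.:* x))
                                 refl (+ suc n) (+ a)))
    (ℚᵘ.≃-sym (toℚᵘ-fromℕ a)))))

fromℕ≡×1 : ∀ n → fromℕ n ≡ n × 1ℚ
fromℕ≡×1 zero    = refl
fromℕ≡×1 (suc n) = trans (fromℕ-suc n) (cong (1ℚ +ℚ_) (fromℕ≡×1 n))

fromℕ-+ : ∀ m n → fromℕ (m + n) ≡ fromℕ m +ℚ fromℕ n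
fromℕ-+ m n = begin
  fromℕ (m + n)             ≡⟨ fromℕ≡×1 (m + n) ⟩
  (m + n) × 1ℚ              ≡⟨ ×-homo-+ 1ℚ m n ⟩
  m × 1ℚ +ℚ n × 1ℚ          ≡⟨ sym (cong₂ _+ℚ_ (fromℕ≡×1 m) (fromℕ≡×1 n)) ⟩
  fromℕ m +ℚ fromℕ n        ∎

fromℕ-* : ∀ m n → fromℕ (m ℕ.* n) ≡ fromℕ m *ℚ fromℕ n
fromℕ-* m n = begin
  fromℕ (m ℕ.* n)           ≡⟨ fromℕ≡×1 (m ℕ.* n) ⟩
  (m ℕ.* n) × 1ℚ            ≡⟨ ×1-homo-* m n ⟩
  m × 1ℚ *ℚ n × 1ℚ          ≡⟨ sym (cong₂ _*ℚ_ (fromℕ≡×1 m) (fromℕ≡×1 n)) ⟩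
  fromℕ m *ℚ fromℕ n        ∎

fromℕ-∸ : ∀ {m n} → n ≤ m → fromℕ (m ∸ n) ≡ fromℕ m - fromℕ n
fromℕ-∸ {m} {n} n≤m = begin
  fromℕ (m ∸ n)                          ≡⟨ solve 2 (λ a b → a := a :+ b :- b) refl (fromℕ (m ∸ n)) (fromℕ n) ⟩
  fromℕ (m ∸ n) +ℚ fromℕ n - fromℕ n     ≡⟨ cong (_- fromℕ n) (sym (fromℕ-+ (m ∸ n) n)) ⟩
  fromℕ (m ∸ n + n) - fromℕ n            ≡⟨ cong (λ k → fromℕ k - fromℕ n) (ℕ.m∸n+n≡m n≤m) ⟩
  fromℕ m - fromℕ n                      ∎

sumTo-cong : ∀ {f g} n → (∀ k → k < n → f (suc k) ≡ g (suc k)) → sumTo f n ≡ sumTo g n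
sumTo-cong zero    f≡g = refl
sumTo-cong (suc n) f≡g = cong₂ _+ℚ_ (sumTo-cong n (λ k k<n → f≡g k (ℕ.m<n⇒m<1+n k<n))) (f≡g n ℕ.≤-refl)

sumTo-cong-≗ : ∀ {f g} n → (∀ k → f k ≡ g k) → sumTo f n ≡ sumTo g n
sumTo-cong-≗ n f≗g = sumTo-cong n (λ k _ → f≗g (suc k))

sumUpTo-cong : ∀ {f g} n → (∀ k → k ≤ n → f k ≡ g k) → sumUpTo f n ≡ sumUpTo g n
sumUpTo-cong zero    f≡g = f≡g zero z≤n
sumUpTo-cong (suc n) f≡g = cong₂ _+ℚ_ (sumUpTo-cong n (λ k k≤n → f≡g k (ℕ.m≤n⇒m≤1+n k≤n))) (f≡g (suc n) ℕ.≤-refl)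

sumTo-distrib-+ : ∀ f g n → sumTo (λ k → f k +ℚ g k) n ≡ sumTo f n +ℚ sumTo g n
sumTo-distrib-+ f g zero    = refl
sumTo-distrib-+ f g (suc n) =
  trans (cong (_+ℚ (f (suc n) +ℚ g (suc n))) (sumTo-distrib-+ f g n))
        (interchange (sumTo f n) (sumTo g n) (f (suc n)) (g (suc n)))

sumUpTo-distrib-+ : ∀ f g n → sumUpTo (λ k → f k +ℚ g k) n ≡ sumUpTo f n +ℚ sumUpTo g n
sumUpTo-distrib-+ f g zero    = refl
sumUpTo-distrib-+ f g (suc n) =
  trans (cong (_+ℚ (f (suc n) +ℚ g (suc n))) (sumUpTo-distrib-+ f g n))
        (interchange (sumUpTo f n) (sumUpTo g n) (f (suc n)) (g (suc n)))

*-distribˡ-sumTo : ∀ c f n → c *ℚ sumTo f n ≡ sumTo (λ k → c *ℚ f k) n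
*-distribˡ-sumTo c f zero    = ℚ.*-zeroʳ c
*-distribˡ-sumTo c f (suc n) =
  trans (ℚ.*-distribˡ-+ c (sumTo f n) (f (suc n))) (cong (_+ℚ c *ℚ f (suc n)) (*-distribˡ-sumTo c f n))

*-distribˡ-sumUpTo : ∀ c f n → c *ℚ sumUpTo f n ≡ sumUpTo (λ k → c *ℚ f k) n
*-distribˡ-sumUpTo c f zero    = refl
*-distribˡ-sumUpTo c f (suc n) =
  trans (ℚ.*-distribˡ-+ c (sumUpTo f n) (f (suc n))) (cong (_+ℚ c *ℚ f (suc n)) (*-distribˡ-sumUpTo c f n))

*-distribʳ-sumTo : ∀ c f n → sumTo f n *ℚ c ≡ sumTo (λ k → f k *ℚ c) n
*-distribʳ-sumTo c f n =
  trans (ℚ.*-comm (sumTo f n) c) (trans (*-distribˡ-sumTo c f n) (sumTo-cong-≗ n (λ k → ℚ.*-comm c (f k))))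

*-distribʳ-sumUpTo : ∀ c f n → sumUpTo f n *ℚ c ≡ sumUpTo (λ k → f k *ℚ c) n
*-distribʳ-sumUpTo c f n =
  trans (ℚ.*-comm (sumUpTo f n) c) (trans (*-distribˡ-sumUpTo c f n) (sumUpTo-cong n (λ k _ → ℚ.*-comm c (f k))))

sumTo-sumUpTo-comm : ∀ (f : ℕ → ℕ → ℚ) m n →
  sumTo (λ k → sumUpTo (λ j → f j k) m) n ≡ sumUpTo (λ j → sumTo (f j) n) m
sumTo-sumUpTo-comm f zero    n = refl
sumTo-sumUpTo-comm f (suc m) n =
  trans (sumTo-distrib-+ (λ k → sumUpTo (λ j → f j k) m) (f (suc m)) n)
        (cong (_+ℚ sumTo (f (suc m)) n) (sumTo-sumUpTo-comm f m n))

sumUpTo-unfoldˡ : ∀ f n → sumUpTo f (suc n) ≡ f zero +ℚ sumUpTo (λ k → f (suc k)) n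
sumUpTo-unfoldˡ f zero    = refl
sumUpTo-unfoldˡ f (suc n) =
  trans (cong (_+ℚ f (suc (suc n))) (sumUpTo-unfoldˡ f n)) (ℚ.+-assoc (f zero) _ _)

sumUpTo-reverse : ∀ f n → sumUpTo f n ≡ sumUpTo (λ k → f (n ∸ k)) n
sumUpTo-reverse f zero    = refl
sumUpTo-reverse f (suc n) = begin
  sumUpTo f n +ℚ f (suc n)                      ≡⟨ cong (_+ℚ f (suc n)) (sumUpTo-reverse f n) ⟩
  sumUpTo (λ k → f (n ∸ k)) n +ℚ f (suc n)      ≡⟨ ℚ.+-comm _ (f (suc n)) ⟩
  f (suc n) +ℚ sumUpTo (λ k → f (n ∸ k)) n      ≡⟨ sym (sumUpTo-unfoldˡ (λ k → f (suc n ∸ k)) n) ⟩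
  sumUpTo (λ k → f (suc n ∸ k)) (suc n)         ∎

sumUpTo-head : ∀ f n → (∀ k → f (suc k) ≡ 0ℚ) → sumUpTo f n ≡ f zero
sumUpTo-head f zero    f≡0 = refl
sumUpTo-head f (suc n) f≡0 = trans (cong₂ _+ℚ_ (sumUpTo-head f n f≡0) (f≡0 n)) (ℚ.+-identityʳ (f zero))

sumUpTo≡∑ : ∀ f n → sumUpTo f n ≡ sum {suc n} (λ i → f (toℕ i))
sumUpTo≡∑ f zero    = sym (ℚ.+-identityʳ (f zero))
sumUpTo≡∑ f (suc n) = trans (sumUpTo-unfoldˡ f n) (cong (f zero +ℚ_) (sumUpTo≡∑ (λ k → f (suc k)) n))

fromℕ-*≡× : ∀ n x → fromℕ n *ℚ x ≡ n × x
fromℕ-*≡× n x = begin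
  fromℕ n *ℚ x      ≡⟨ cong (_*ℚ x) (fromℕ≡×1 n) ⟩
  (n × 1ℚ) *ℚ x     ≡⟨ ×-assoc-* n 1ℚ x ⟩
  n × (1ℚ *ℚ x)     ≡⟨ cong (n ×_) (ℚ.*-identityˡ x) ⟩
  n × x             ∎

binomial-theorem : ∀ x y n → (x +ℚ y) ^ n ≡ sumUpTo (λ k → fromℕ (n C k) *ℚ (x ^ k *ℚ y ^ (n ∸ k))) n
binomial-theorem x y n = begin
  (x +ℚ y) ^ n                   ≡⟨ Binomial.theorem n x y ⟩
  Binomial.binomialExpansion x y n ≡⟨ sym (sumUpTo≡∑ (λ k → (n C k) × (x ^ k *ℚ y ^ (n ∸ k))) n) ⟩
  sumUpTo (λ k → (n C k) × (x ^ k *ℚ y ^ (n ∸ k))) n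
    ≡⟨ sumUpTo-cong n (λ k _ → sym (fromℕ-*≡× (n C k) _)) ⟩
  sumUpTo (λ k → fromℕ (n C k) *ℚ (x ^ k *ℚ y ^ (n ∸ k))) n ∎

1^n≡1 : ∀ n → 1ℚ ^ n ≡ 1ℚ
1^n≡1 zero    = refl
1^n≡1 (suc n) = trans (ℚ.*-identityˡ (1ℚ ^ n)) (1^n≡1 n)

-x^n≡sign*x^n : ∀ x n → (- x) ^ n ≡ sign n *ℚ x ^ n
-x^n≡sign*x^n x zero    = sym (ℚ.*-identityˡ 1ℚ)
-x^n≡sign*x^n x (suc n) = begin
  (- x) *ℚ (- x) ^ n          ≡⟨ cong ((- x) *ℚ_) (-x^n≡sign*x^n x n) ⟩
  (- x) *ℚ (sign n *ℚ x ^ n)  ≡⟨ solve 3 (λ a s p → (:- a) :* (s :* p) := (:- s) :* (a :* p)) refl x (sign n) (x ^ n) ⟩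
  (- sign n) *ℚ (x *ℚ x ^ n)  ∎

alternating-binomial-sum : ∀ n → sumUpTo (λ k → sign k *ℚ fromℕ (suc n C k)) (suc n) ≡ 0ℚ
alternating-binomial-sum n = begin
  sumUpTo (λ k → sign k *ℚ fromℕ (suc n C k)) (suc n)
    ≡⟨ sumUpTo-cong (suc n) (λ k _ → term k) ⟩
  sumUpTo (λ k → fromℕ (suc n C k) *ℚ ((- 1ℚ) ^ k *ℚ 1ℚ ^ (suc n ∸ k))) (suc n)
    ≡⟨ sym (binomial-theorem (- 1ℚ) 1ℚ (suc n)) ⟩
  0ℚ *ℚ 0ℚ ^ n
    ≡⟨ ℚ.*-zeroˡ (0ℚ ^ n) ⟩
  0ℚ ∎
  where
  term : ∀ k → sign k *ℚ fromℕ (suc n C k) ≡ fromℕ (suc n C k) *ℚ ((- 1ℚ) ^ k *ℚ 1ℚ ^ (suc n ∸ k))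
  term k = sym (begin
    fromℕ (suc n C k) *ℚ ((- 1ℚ) ^ k *ℚ 1ℚ ^ (suc n ∸ k))
      ≡⟨ cong₂ (λ a b → fromℕ (suc n C k) *ℚ (a *ℚ b))
           (trans (-x^n≡sign*x^n 1ℚ k) (cong (sign k *ℚ_) (1^n≡1 k))) (1^n≡1 (suc n ∸ k)) ⟩
    fromℕ (suc n C k) *ℚ (sign k *ℚ 1ℚ *ℚ 1ℚ)
      ≡⟨ solve 2 (λ c s → c :* (s :* con 1ℚ :* con 1ℚ) := s :* c) refl (fromℕ (suc n C k)) (sign k) ⟩
    sign k *ℚ fromℕ (suc n C k) ∎)

invPow-suc≡^ : ∀ j s → invPow (suc j) s ≡ ((+ 1) / suc j) ^ s
invPow-suc≡^ j zero    = refl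
invPow-suc≡^ j (suc s) = trans (ℚ.*-comm (invPow (suc j) s) _) (cong (((+ 1) / suc j) *ℚ_) (invPow-suc≡^ j s))

invPow-+ : ∀ n a b → invPow n (a + b) ≡ invPow n a *ℚ invPow n b
invPow-+ zero    a b = refl
invPow-+ (suc j) a b = begin
  invPow (suc j) (a + b)                  ≡⟨ invPow-suc≡^ j (a + b) ⟩
  w ^ (a + b)                             ≡⟨ ^-homo-* w a b ⟩
  w ^ a *ℚ w ^ b                          ≡⟨ sym (cong₂ _*ℚ_ (invPow-suc≡^ j a) (invPow-suc≡^ j b)) ⟩
  invPow (suc j) a *ℚ invPow (suc j) b    ∎
  where w = (+ 1) / suc j

fromℕ^-*-invPow : ∀ j {k s} → k ≤ s → fromℕ (suc j) ^ k *ℚ invPow (suc j) s ≡ invPow (suc j) (s ∸ k)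
fromℕ^-*-invPow j {k} {s} k≤s = begin
  x ^ k *ℚ invPow (suc j) s                              ≡⟨ cong (λ t → x ^ k *ℚ invPow (suc j) t) (sym (ℕ.m+[n∸m]≡n k≤s)) ⟩
  x ^ k *ℚ invPow (suc j) (k + (s ∸ k))                  ≡⟨ cong (x ^ k *ℚ_) (invPow-+ (suc j) k (s ∸ k)) ⟩
  x ^ k *ℚ (invPow (suc j) k *ℚ invPow (suc j) (s ∸ k))  ≡⟨ sym (ℚ.*-assoc (x ^ k) _ _) ⟩
  x ^ k *ℚ invPow (suc j) k *ℚ invPow (suc j) (s ∸ k)    ≡⟨ cong (λ t → x ^ k *ℚ t *ℚ invPow (suc j) (s ∸ k)) (invPow-suc≡^ j k) ⟩
  x ^ k *ℚ w ^ k *ℚ invPow (suc j) (s ∸ k)               ≡⟨ cong (_*ℚ invPow (suc j) (s ∸ k)) (sym (^-distrib-* x w k)) ⟩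
  (x *ℚ w) ^ k *ℚ invPow (suc j) (s ∸ k)                 ≡⟨ cong (λ t → t ^ k *ℚ invPow (suc j) (s ∸ k)) (fromℕ-*-/ (suc j) 1) ⟩
  1ℚ ^ k *ℚ invPow (suc j) (s ∸ k)                       ≡⟨ cong (_*ℚ invPow (suc j) (s ∸ k)) (1^n≡1 k) ⟩
  1ℚ *ℚ invPow (suc j) (s ∸ k)                           ≡⟨ ℚ.*-identityˡ _ ⟩
  invPow (suc j) (s ∸ k)                                 ∎
  where x = fromℕ (suc j)
        w = (+ 1) / suc j

sumUpTo-dropLast : ∀ f n → f (suc n) ≡ 0ℚ → sumUpTo f (suc n) ≡ sumUpTo f n
sumUpTo-dropLast f n f≡0 = trans (cong (sumUpTo f n +ℚ_) f≡0) (ℚ.+-identityʳ (sumUpTo f n))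

sumUpTo-dropHead : ∀ f n → f zero ≡ 0ℚ → sumUpTo f (suc n) ≡ sumUpTo (λ k → f (suc k)) n
sumUpTo-dropHead f n f≡0 =
  trans (sumUpTo-unfoldˡ f n) (trans (cong (_+ℚ rest) f≡0) (ℚ.+-identityˡ rest))
  where rest = sumUpTo (λ k → f (suc k)) n

n<k⇒stirling1[n,k]≡0 : ∀ {n k} → n < k → stirling1 n k ≡ 0
n<k⇒stirling1[n,k]≡0 {zero}  {suc k} _ = refl
n<k⇒stirling1[n,k]≡0 {suc n} {suc k} (ℕ.s≤s n<k)
  rewrite n<k⇒stirling1[n,k]≡0 (ℕ.m<n⇒m<1+n n<k) | n<k⇒stirling1[n,k]≡0 n<k = trans (ℕ.+-identityʳ (n ℕ.* 0)) (ℕ.*-zeroʳ n)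

stirling1[1+n,1]≡n! : ∀ n → stirling1 (suc n) 1 ≡ n !
stirling1[1+n,1]≡n! zero = refl
stirling1[1+n,1]≡n! (suc n) rewrite stirling1[1+n,1]≡n! n = ℕ.+-identityʳ (suc n ℕ.* n !)

rising : ℕ → ℚ → ℚ
rising zero    x = 1ℚ
rising (suc q) x = rising q x *ℚ (x +ℚ fromℕ (suc q))

rising≡stirlingPoly : ∀ q x → rising q x ≡ sumUpTo (λ m → fromℕ (stirling1 (suc q) (suc m)) *ℚ x ^ m) q
rising≡stirlingPoly zero    x = refl
rising≡stirlingPoly (suc q) x = begin
  rising q x *ℚ (x +ℚ c)                        ≡⟨ cong (_*ℚ (x +ℚ c)) (rising≡stirlingPoly q x) ⟩
  S *ℚ (x +ℚ c)                                 ≡⟨ solve 3 (λ s y z → s :* (y :+ z) := z :* s :+ y :* s) refl S x c ⟩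
  c *ℚ S +ℚ x *ℚ S                              ≡⟨ cong₂ _+ℚ_ c*S x*S ⟩
  sumUpTo scaled (suc q) +ℚ sumUpTo shifted (suc q)
    ≡⟨ sym (sumUpTo-distrib-+ scaled shifted (suc q)) ⟩
  sumUpTo (λ m → scaled m +ℚ shifted m) (suc q)
    ≡⟨ sumUpTo-cong (suc q) (λ m _ → stirling-recurrence m) ⟩
  sumUpTo (λ m → fromℕ (stirling1 (suc (suc q)) (suc m)) *ℚ x ^ m) (suc q) ∎
  where
  c = fromℕ (suc q)
  st : ℕ → ℚ
  st m = fromℕ (stirling1 (suc q) m)
  S = sumUpTo (λ m → st (suc m) *ℚ x ^ m) q
  scaled shifted : ℕ → ℚ
  scaled m  = c *ℚ st (suc m) *ℚ x ^ m
  shifted m = st m *ℚ x ^ m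
  c*S : c *ℚ S ≡ sumUpTo scaled (suc q)
  c*S = begin
    c *ℚ S                                             ≡⟨ *-distribˡ-sumUpTo c _ q ⟩
    sumUpTo (λ m → c *ℚ (st (suc m) *ℚ x ^ m)) q       ≡⟨ sumUpTo-cong q (λ m _ → sym (ℚ.*-assoc c _ _)) ⟩
    sumUpTo scaled q                                   ≡⟨ sym (sumUpTo-dropLast scaled q scaled-top≡0) ⟩
    sumUpTo scaled (suc q)                             ∎
    where
    scaled-top≡0 : scaled (suc q) ≡ 0ℚ
    scaled-top≡0 = trans
      (cong (λ s → c *ℚ fromℕ s *ℚ x ^ suc q) (n<k⇒stirling1[n,k]≡0 {suc q} {suc (suc q)} ℕ.≤-refl))
      (solve 2 (λ a b → a :* con 0ℚ :* b := con 0ℚ) refl c (x ^ suc q))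
  x*S : x *ℚ S ≡ sumUpTo shifted (suc q)
  x*S = begin
    x *ℚ S                                             ≡⟨ *-distribˡ-sumUpTo x _ q ⟩
    sumUpTo (λ m → x *ℚ (st (suc m) *ℚ x ^ m)) q
      ≡⟨ sumUpTo-cong q (λ m _ → solve 3 (λ y s p → y :* (s :* p) := s :* (y :* p)) refl x (st (suc m)) (x ^ m)) ⟩
    sumUpTo (λ m → shifted (suc m)) q                  ≡⟨ sym (sumUpTo-dropHead shifted q (ℚ.*-zeroˡ 1ℚ)) ⟩
    sumUpTo shifted (suc q)                            ∎
  stirling-recurrence : ∀ m → scaled m +ℚ shifted m ≡ fromℕ (stirling1 (suc (suc q)) (suc m)) *ℚ x ^ m
  stirling-recurrence m = begin
    c *ℚ st (suc m) *ℚ x ^ m +ℚ st m *ℚ x ^ m   ≡⟨ sym (ℚ.*-distribʳ-+ (x ^ m) (c *ℚ st (suc m)) (st m)) ⟩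
    (c *ℚ st (suc m) +ℚ st m) *ℚ x ^ m
      ≡⟨ cong (λ t → (t +ℚ st m) *ℚ x ^ m) (sym (fromℕ-* (suc q) (stirling1 (suc q) (suc m)))) ⟩
    (fromℕ (suc q ℕ.* stirling1 (suc q) (suc m)) +ℚ st m) *ℚ x ^ m
      ≡⟨ cong (_*ℚ x ^ m) (sym (fromℕ-+ (suc q ℕ.* stirling1 (suc q) (suc m)) (stirling1 (suc q) m))) ⟩
    fromℕ (stirling1 (suc (suc q)) (suc m)) *ℚ x ^ m ∎

rising-zero : ∀ q → rising q 0ℚ ≡ fromℕ (q !)
rising-zero zero    = refl
rising-zero (suc q) = begin
  rising q 0ℚ *ℚ (0ℚ +ℚ fromℕ (suc q))   ≡⟨ cong₂ _*ℚ_ (rising-zero q) (ℚ.+-identityˡ (fromℕ (suc q))) ⟩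
  fromℕ (q !) *ℚ fromℕ (suc q)           ≡⟨ ℚ.*-comm (fromℕ (q !)) (fromℕ (suc q)) ⟩
  fromℕ (suc q) *ℚ fromℕ (q !)           ≡⟨ sym (fromℕ-* (suc q) (q !)) ⟩
  fromℕ (suc q !)                        ∎

rising-suc-shift : ∀ q x → rising (suc q) x ≡ (x +ℚ 1ℚ) *ℚ rising q (x +ℚ 1ℚ)
rising-suc-shift zero    x = solve 1 (λ y → con 1ℚ :* (y :+ con 1ℚ) := (y :+ con 1ℚ) :* con 1ℚ) refl x
rising-suc-shift (suc q) x = begin
  rising (suc q) x *ℚ (x +ℚ fromℕ (suc (suc q)))
    ≡⟨ cong₂ _*ℚ_ (rising-suc-shift q x) (cong (x +ℚ_) (fromℕ-suc (suc q))) ⟩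
  (x +ℚ 1ℚ) *ℚ rising q (x +ℚ 1ℚ) *ℚ (x +ℚ (1ℚ +ℚ fromℕ (suc q)))
    ≡⟨ solve 3 (λ y r c → (y :+ con 1ℚ) :* r :* (y :+ (con 1ℚ :+ c)) := (y :+ con 1ℚ) :* (r :* ((y :+ con 1ℚ) :+ c)))
         refl x (rising q (x +ℚ 1ℚ)) (fromℕ (suc q)) ⟩
  (x +ℚ 1ℚ) *ℚ rising (suc q) (x +ℚ 1ℚ) ∎

rising-+1 : ∀ q x → rising (suc q) (x +ℚ 1ℚ) ≡ rising (suc q) x +ℚ fromℕ (suc q) *ℚ rising q (x +ℚ 1ℚ)
rising-+1 q x = begin
  rising q y *ℚ (y +ℚ c)                 ≡⟨ solve 3 (λ r a b → r :* (a :+ b) := a :* r :+ b :* r) refl (rising q y) y c ⟩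
  y *ℚ rising q y +ℚ c *ℚ rising q y     ≡⟨ cong (_+ℚ c *ℚ rising q y) (sym (rising-suc-shift q x)) ⟩
  rising (suc q) x +ℚ c *ℚ rising q y    ∎
  where y = x +ℚ 1ℚ
        c = fromℕ (suc q)

risingConv : ℕ → (ℕ → ℚ) → ℕ → ℚ
risingConv q u n = sumTo (λ k → rising q (fromℕ (n ∸ k)) *ℚ u k) n

risingConv-suc : ∀ q u n →
  risingConv (suc q) u (suc n) ≡ risingConv (suc q) u n +ℚ fromℕ (suc q) *ℚ risingConv q u (suc n)
risingConv-suc q u n = begin
  risingConv (suc q) u (suc n)
    ≡⟨ cong₂ _+ℚ_ (sumTo-cong n (λ k k<n → termwise k k<n)) top ⟩
  sumTo (λ k → old k +ℚ new k) n +ℚ new (suc n)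
    ≡⟨ cong (_+ℚ new (suc n)) (sumTo-distrib-+ old new n) ⟩
  risingConv (suc q) u n +ℚ sumTo new n +ℚ new (suc n)
    ≡⟨ ℚ.+-assoc (risingConv (suc q) u n) (sumTo new n) (new (suc n)) ⟩
  risingConv (suc q) u n +ℚ sumTo new (suc n)
    ≡⟨ cong (risingConv (suc q) u n +ℚ_) (sym (*-distribˡ-sumTo c _ (suc n))) ⟩
  risingConv (suc q) u n +ℚ c *ℚ risingConv q u (suc n) ∎
  where
  c = fromℕ (suc q)
  old new : ℕ → ℚ
  old k = rising (suc q) (fromℕ (n ∸ k)) *ℚ u k
  new k = c *ℚ (rising q (fromℕ (suc n ∸ k)) *ℚ u k)
  termwise : ∀ i → i < n → rising (suc q) (fromℕ (n ∸ i)) *ℚ u (suc i) ≡ old (suc i) +ℚ new (suc i)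
  termwise i i<n = begin
    rising (suc q) (fromℕ (n ∸ i)) *ℚ u (suc i)
      ≡⟨ cong (λ y → rising (suc q) y *ℚ u (suc i)) x+1 ⟩
    rising (suc q) (x +ℚ 1ℚ) *ℚ u (suc i)
      ≡⟨ cong (_*ℚ u (suc i)) (rising-+1 q x) ⟩
    (rising (suc q) x +ℚ c *ℚ rising q (x +ℚ 1ℚ)) *ℚ u (suc i)
      ≡⟨ solve 4 (λ a b r v → (a :+ b :* r) :* v := a :* v :+ b :* (r :* v)) refl (rising (suc q) x) c (rising q (x +ℚ 1ℚ)) (u (suc i)) ⟩
    rising (suc q) x *ℚ u (suc i) +ℚ c *ℚ (rising q (x +ℚ 1ℚ) *ℚ u (suc i))
      ≡⟨ cong (λ y → old (suc i) +ℚ c *ℚ (rising q y *ℚ u (suc i))) (sym x+1) ⟩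
    old (suc i) +ℚ new (suc i) ∎
    where
    x = fromℕ (n ∸ suc i)
    x+1 : fromℕ (n ∸ i) ≡ x +ℚ 1ℚ
    x+1 = trans (cong fromℕ (ℕ.+-∸-assoc 1 i<n)) (trans (fromℕ-suc (n ∸ suc i)) (ℚ.+-comm 1ℚ x))
  top : rising (suc q) (fromℕ (suc n ∸ suc n)) *ℚ u (suc n) ≡ new (suc n)
  top = begin
    rising (suc q) (fromℕ (n ∸ n)) *ℚ u (suc n)   ≡⟨ cong (λ t → rising (suc q) (fromℕ t) *ℚ u (suc n)) (ℕ.n∸n≡0 n) ⟩
    rising (suc q) 0ℚ *ℚ u (suc n)                ≡⟨ cong (_*ℚ u (suc n)) (trans (rising-zero (suc q)) (fromℕ-* (suc q) (q !))) ⟩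
    c *ℚ fromℕ (q !) *ℚ u (suc n)                 ≡⟨ ℚ.*-assoc c (fromℕ (q !)) (u (suc n)) ⟩
    c *ℚ (fromℕ (q !) *ℚ u (suc n))
      ≡⟨ cong (λ t → c *ℚ (t *ℚ u (suc n))) (sym (trans (cong (λ t → rising q (fromℕ t)) (ℕ.n∸n≡0 n)) (rising-zero q))) ⟩
    new (suc n)                                   ∎

q!*hyper≡risingConv : ∀ q p n → fromℕ (q !) *ℚ hyper p (suc q) n ≡ risingConv q (λ k → invPow k p) n
q!*hyper≡risingConv zero    p n = trans (ℚ.*-identityˡ (hyper p 1 n)) (sumTo-cong-≗ n (λ k → sym (ℚ.*-identityˡ (invPow k p))))
q!*hyper≡risingConv (suc q) p zero    = ℚ.*-zeroʳ (fromℕ (suc q !))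
q!*hyper≡risingConv (suc q) p (suc n) = begin
  F *ℚ (hyper p (suc (suc q)) n +ℚ hyper p (suc q) (suc n))
    ≡⟨ ℚ.*-distribˡ-+ F (hyper p (suc (suc q)) n) (hyper p (suc q) (suc n)) ⟩
  F *ℚ hyper p (suc (suc q)) n +ℚ F *ℚ hyper p (suc q) (suc n)
    ≡⟨ cong₂ _+ℚ_ (q!*hyper≡risingConv (suc q) p n) (cong (_*ℚ hyper p (suc q) (suc n)) (fromℕ-* (suc q) (q !))) ⟩
  risingConv (suc q) u n +ℚ c *ℚ fromℕ (q !) *ℚ hyper p (suc q) (suc n)
    ≡⟨ cong (risingConv (suc q) u n +ℚ_) (trans (ℚ.*-assoc c (fromℕ (q !)) _) (cong (c *ℚ_) (q!*hyper≡risingConv q p (suc n)))) ⟩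
  risingConv (suc q) u n +ℚ c *ℚ risingConv q u (suc n)
    ≡⟨ sym (risingConv-suc q u n) ⟩
  risingConv (suc q) u (suc n) ∎
  where
  F = fromℕ (suc q !)
  c = fromℕ (suc q)
  u : ℕ → ℚ
  u k = invPow k p

triangleSum : ℕ → (ℕ → ℕ → ℚ) → ℚ
triangleSum q f = sumUpTo (λ m → sumUpTo (f m) m) q

triangleSum-cong : ∀ {f g} q → (∀ m k → k ≤ m → m ≤ q → f m k ≡ g m k) → triangleSum q f ≡ triangleSum q g
triangleSum-cong q f≡g = sumUpTo-cong q (λ m m≤q → sumUpTo-cong m (λ k k≤m → f≡g m k k≤m m≤q))

triangleSum-distrib-+ : ∀ f g q → triangleSum q (λ m k → f m k +ℚ g m k) ≡ triangleSum q f +ℚ triangleSum q g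
triangleSum-distrib-+ f g q =
  trans (sumUpTo-cong q (λ m _ → sumUpTo-distrib-+ (f m) (g m) m))
        (sumUpTo-distrib-+ (λ m → sumUpTo (f m) m) (λ m → sumUpTo (g m) m) q)

sumTo-triangleSum-comm : ∀ (f : ℕ → ℕ → ℕ → ℚ) q N →
  sumTo (λ n → triangleSum q (λ m k → f m k n)) N ≡ triangleSum q (λ m k → sumTo (f m k) N)
sumTo-triangleSum-comm f q N =
  trans (sumTo-sumUpTo-comm (λ m n → sumUpTo (λ k → f m k n) m) q N)
        (sumUpTo-cong q (λ m _ → sumTo-sumUpTo-comm (f m) m N))

r∸[m∸k]≡r+k∸m : ∀ r {k m} → k ≤ m → r ∸ (m ∸ k) ≡ (r + k) ∸ m
r∸[m∸k]≡r+k∸m r {k} {m} k≤m = sym (begin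
  (r + k) ∸ m                  ≡⟨ cong₂ _∸_ (ℕ.+-comm r k) (sym (ℕ.m+[n∸m]≡n k≤m)) ⟩
  (k + r) ∸ (k + (m ∸ k))      ≡⟨ ℕ.[m+n]∸[m+o]≡n∸o k r (m ∸ k) ⟩
  r ∸ (m ∸ k)                  ∎)

coeff : ℕ → ℕ → ℕ → ℚ
coeff q m k = sign k *ℚ fromℕ (stirling1 (suc q) (suc m)) *ℚ fromℕ (m C k)

monomial-expansion : ∀ {m p r} → m ≤ p → m ≤ r → ∀ {k n} → k ≤ n →
  (fromℕ (suc n) - fromℕ (suc k)) ^ m *ℚ (invPow (suc k) p *ℚ invPow (suc n) r)
  ≡ sumUpTo (λ j → sign j *ℚ fromℕ (m C j) *ℚ (invPow (suc k) (p ∸ j) *ℚ invPow (suc n) ((r + j) ∸ m))) m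
monomial-expansion {m} {p} {r} m≤p m≤r {k} {n} k≤n = begin
  (N - K) ^ m *ℚ (u *ℚ v)
    ≡⟨ cong (λ x → x ^ m *ℚ (u *ℚ v)) (ℚ.+-comm N (- K)) ⟩
  ((- K) +ℚ N) ^ m *ℚ (u *ℚ v)
    ≡⟨ cong (_*ℚ (u *ℚ v)) (binomial-theorem (- K) N m) ⟩
  sumUpTo (λ j → fromℕ (m C j) *ℚ ((- K) ^ j *ℚ N ^ (m ∸ j))) m *ℚ (u *ℚ v)
    ≡⟨ *-distribʳ-sumUpTo (u *ℚ v) _ m ⟩
  sumUpTo (λ j → fromℕ (m C j) *ℚ ((- K) ^ j *ℚ N ^ (m ∸ j)) *ℚ (u *ℚ v)) m
    ≡⟨ sumUpTo-cong m term ⟩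
  sumUpTo (λ j → sign j *ℚ fromℕ (m C j) *ℚ (invPow (suc k) (p ∸ j) *ℚ invPow (suc n) ((r + j) ∸ m))) m ∎
  where
  N = fromℕ (suc n)
  K = fromℕ (suc k)
  u = invPow (suc k) p
  v = invPow (suc n) r
  term : ∀ j → j ≤ m → fromℕ (m C j) *ℚ ((- K) ^ j *ℚ N ^ (m ∸ j)) *ℚ (u *ℚ v)
                       ≡ sign j *ℚ fromℕ (m C j) *ℚ (invPow (suc k) (p ∸ j) *ℚ invPow (suc n) ((r + j) ∸ m))
  term j j≤m = begin
    fromℕ (m C j) *ℚ ((- K) ^ j *ℚ N ^ (m ∸ j)) *ℚ (u *ℚ v)
      ≡⟨ cong (λ x → fromℕ (m C j) *ℚ (x *ℚ N ^ (m ∸ j)) *ℚ (u *ℚ v)) (-x^n≡sign*x^n K j) ⟩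
    fromℕ (m C j) *ℚ (sign j *ℚ K ^ j *ℚ N ^ (m ∸ j)) *ℚ (u *ℚ v)
      ≡⟨ solve 6 (λ c s a b x y → c :* (s :* a :* b) :* (x :* y) := s :* c :* ((a :* x) :* (b :* y))) refl
           (fromℕ (m C j)) (sign j) (K ^ j) (N ^ (m ∸ j)) u v ⟩
    sign j *ℚ fromℕ (m C j) *ℚ (K ^ j *ℚ u *ℚ (N ^ (m ∸ j) *ℚ v))
      ≡⟨ cong₂ (λ x y → sign j *ℚ fromℕ (m C j) *ℚ (x *ℚ y))
           (fromℕ^-*-invPow k (ℕ.≤-trans j≤m m≤p))
           (trans (fromℕ^-*-invPow n (ℕ.≤-trans (ℕ.m∸n≤m m j) m≤r)) (cong (invPow (suc n)) (r∸[m∸k]≡r+k∸m r j≤m))) ⟩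
    sign j *ℚ fromℕ (m C j) *ℚ (invPow (suc k) (p ∸ j) *ℚ invPow (suc n) ((r + j) ∸ m)) ∎

rising-expansion : ∀ {q p r} → q ≤ p → q ≤ r → ∀ {k n} → k ≤ n →
  rising q (fromℕ (suc n ∸ suc k)) *ℚ invPow (suc k) p *ℚ invPow (suc n) r
  ≡ triangleSum q (λ m j → coeff q m j *ℚ (invPow (suc k) (p ∸ j) *ℚ invPow (suc n) ((r + j) ∸ m)))
rising-expansion {q} {p} {r} q≤p q≤r {k} {n} k≤n = begin
  rising q (fromℕ (n ∸ k)) *ℚ u *ℚ v
    ≡⟨ cong (λ x → rising q x *ℚ u *ℚ v) (fromℕ-∸ (ℕ.s≤s k≤n)) ⟩
  rising q x *ℚ u *ℚ v
    ≡⟨ trans (ℚ.*-assoc (rising q x) u v) (cong (_*ℚ (u *ℚ v)) (rising≡stirlingPoly q x)) ⟩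
  sumUpTo (λ m → st m *ℚ x ^ m) q *ℚ (u *ℚ v)
    ≡⟨ *-distribʳ-sumUpTo (u *ℚ v) _ q ⟩
  sumUpTo (λ m → st m *ℚ x ^ m *ℚ (u *ℚ v)) q
    ≡⟨ sumUpTo-cong q (λ m m≤q → trans (ℚ.*-assoc (st m) (x ^ m) (u *ℚ v))
         (cong (st m *ℚ_) (monomial-expansion (ℕ.≤-trans m≤q q≤p) (ℕ.≤-trans m≤q q≤r) k≤n))) ⟩
  sumUpTo (λ m → st m *ℚ sumUpTo (λ j → sign j *ℚ fromℕ (m C j) *ℚ E m j) m) q
    ≡⟨ sumUpTo-cong q (λ m _ → trans (*-distribˡ-sumUpTo (st m) _ m) (sumUpTo-cong m (λ j _ →
         solve 4 (λ a s c e → a :* (s :* c :* e) := s :* a :* c :* e) refl (st m) (sign j) (fromℕ (m C j)) (E m j)))) ⟩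
  triangleSum q (λ m j → coeff q m j *ℚ E m j) ∎
  where
  x = fromℕ (suc n) - fromℕ (suc k)
  u = invPow (suc k) p
  v = invPow (suc n) r
  st : ℕ → ℚ
  st m = fromℕ (stirling1 (suc q) (suc m))
  E : ℕ → ℕ → ℚ
  E m j = invPow (suc k) (p ∸ j) *ℚ invPow (suc n) ((r + j) ∸ m)

eulerN-double-sum : ∀ c a b N → c *ℚ eulerN a b N ≡ sumTo (λ n → sumTo (λ k → c *ℚ (invPow k a *ℚ invPow n b)) n) N
eulerN-double-sum c a b N =
  trans (*-distribˡ-sumTo c _ N) (sumTo-cong-≗ N (λ n →
    trans (cong (c *ℚ_) (*-distribʳ-sumTo (invPow n b) (λ k → invPow k a) n)) (*-distribˡ-sumTo c _ n)))

eulerTerm : ℕ → ℕ → ℕ → ℕ → ℕ → ℕ → ℚ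
eulerTerm q p r N m k = coeff q m k *ℚ eulerN (p ∸ k) ((r + k) ∸ m) N

q!*hypEulerN≡triangleSum : ∀ {q p r} → q ≤ p → q ≤ r → ∀ N →
  fromℕ (q !) *ℚ hypEulerN p (suc q) r N ≡ triangleSum q (eulerTerm q p r N)
q!*hypEulerN≡triangleSum {q} {p} {r} q≤p q≤r N = begin
  F *ℚ hypEulerN p (suc q) r N
    ≡⟨ trans (*-distribˡ-sumTo F _ N) (sumTo-cong-≗ N (λ n →
         trans (sym (ℚ.*-assoc F (hyper p (suc q) n) (invPow n r))) (cong (_*ℚ invPow n r) (q!*hyper≡risingConv q p n)))) ⟩
  sumTo (λ n → risingConv q (λ k → invPow k p) n *ℚ invPow n r) N
    ≡⟨ sumTo-cong-≗ N (λ n → *-distribʳ-sumTo (invPow n r) _ n) ⟩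
  sumTo (λ n → sumTo (λ k → rising q (fromℕ (n ∸ k)) *ℚ invPow k p *ℚ invPow n r) n) N
    ≡⟨ sumTo-cong N (λ n _ → sumTo-cong (suc n) (λ k k≤n → rising-expansion q≤p q≤r (ℕ.s≤s⁻¹ k≤n))) ⟩
  sumTo (λ n → sumTo (λ k → triangleSum q (λ m j → T m j k n)) n) N
    ≡⟨ sumTo-cong-≗ N (λ n → sumTo-triangleSum-comm (λ m j k → T m j k n) q n) ⟩
  sumTo (λ n → triangleSum q (λ m j → sumTo (λ k → T m j k n) n)) N
    ≡⟨ sumTo-triangleSum-comm (λ m j n → sumTo (λ k → T m j k n) n) q N ⟩
  triangleSum q (λ m j → sumTo (λ n → sumTo (λ k → T m j k n) n) N)
    ≡⟨ triangleSum-cong q (λ m j _ _ → sym (eulerN-double-sum (coeff q m j) (p ∸ j) ((r + j) ∸ m) N)) ⟩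
  triangleSum q (eulerTerm q p r N) ∎
  where
  F = fromℕ (q !)
  T : ℕ → ℕ → ℕ → ℕ → ℚ
  T m j k n = coeff q m j *ℚ (invPow k (p ∸ j) *ℚ invPow n ((r + j) ∸ m))

eulerN-reflection : ∀ a b N → eulerN a b N +ℚ eulerN b a N ≡ zetaN a N *ℚ zetaN b N +ℚ zetaN (a + b) N
eulerN-reflection a b zero    = refl
eulerN-reflection a b (suc N) = begin
  (eulerN a b N +ℚ (Za +ℚ u) *ℚ v) +ℚ (eulerN b a N +ℚ (Zb +ℚ v) *ℚ u)
    ≡⟨ solve 6 (λ e e′ x y s t → (e :+ (x :+ s) :* t) :+ (e′ :+ (y :+ t) :* s) := (e :+ e′) :+ ((x :+ s) :* t :+ (y :+ t) :* s)) refl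
         (eulerN a b N) (eulerN b a N) Za Zb u v ⟩
  (eulerN a b N +ℚ eulerN b a N) +ℚ ((Za +ℚ u) *ℚ v +ℚ (Zb +ℚ v) *ℚ u)
    ≡⟨ cong (_+ℚ ((Za +ℚ u) *ℚ v +ℚ (Zb +ℚ v) *ℚ u)) (eulerN-reflection a b N) ⟩
  (Za *ℚ Zb +ℚ zetaN (a + b) N) +ℚ ((Za +ℚ u) *ℚ v +ℚ (Zb +ℚ v) *ℚ u)
    ≡⟨ solve 5 (λ x y z s t → (x :* y :+ z) :+ ((x :+ s) :* t :+ (y :+ t) :* s) := (x :+ s) :* (y :+ t) :+ (z :+ s :* t)) refl
         Za Zb (zetaN (a + b) N) u v ⟩
  (Za +ℚ u) *ℚ (Zb +ℚ v) +ℚ (zetaN (a + b) N +ℚ u *ℚ v)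
    ≡⟨ cong (λ w → (Za +ℚ u) *ℚ (Zb +ℚ v) +ℚ (zetaN (a + b) N +ℚ w)) (sym (invPow-+ (suc N) a b)) ⟩
  zetaN a (suc N) *ℚ zetaN b (suc N) +ℚ zetaN (a + b) (suc N) ∎
  where
  Za = zetaN a N
  Zb = zetaN b N
  u = invPow (suc N) a
  v = invPow (suc N) b

sign-+ : ∀ m n → sign (m + n) ≡ sign m *ℚ sign n
sign-+ zero    n = sym (ℚ.*-identityˡ (sign n))
sign-+ (suc m) n = trans (cong -_ (sign-+ m n)) (ℚ.neg-distribˡ-* (sign m) (sign n))

sign*sign≡1 : ∀ n → sign n *ℚ sign n ≡ 1ℚ
sign*sign≡1 zero    = refl
sign*sign≡1 (suc n) = trans (solve 1 (λ s → (:- s) :* (:- s) := s :* s) refl (sign n)) (sign*sign≡1 n)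

sign-∸ : ∀ {m n} → n ≤ m → sign (m ∸ n) ≡ sign (m + n)
sign-∸ {m} {n} n≤m = begin
  sign (m ∸ n)                          ≡⟨ sym (trans (cong (sign (m ∸ n) *ℚ_) (sign*sign≡1 n)) (ℚ.*-identityʳ (sign (m ∸ n)))) ⟩
  sign (m ∸ n) *ℚ (sign n *ℚ sign n)    ≡⟨ sym (ℚ.*-assoc (sign (m ∸ n)) (sign n) (sign n)) ⟩
  sign (m ∸ n) *ℚ sign n *ℚ sign n      ≡⟨ cong (_*ℚ sign n) (sym (sign-+ (m ∸ n) n)) ⟩
  sign (m ∸ n + n) *ℚ sign n            ≡⟨ cong (λ t → sign t *ℚ sign n) (ℕ.m∸n+n≡m n≤m) ⟩
  sign m *ℚ sign n                      ≡⟨ sym (sign-+ m n) ⟩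
  sign (m + n)                          ∎

sign≡if-odd : ∀ n → sign n ≡ (if isOdd n then - 1ℚ else 1ℚ)
sign≡if-odd zero    = refl
sign≡if-odd (suc n) with isOdd n | sign≡if-odd n
... | true  | s≡-1 = cong -_ s≡-1
... | false | s≡1  = cong -_ s≡1

sign[n]-sign[m+n] : ∀ m n → sign n - sign (m + n) ≡ (if isOdd m then fromℕ 2 else 0ℚ) *ℚ sign n
sign[n]-sign[m+n] m n = begin
  sign n - sign (m + n)                        ≡⟨ cong (λ s → sign n - s) (sign-+ m n) ⟩
  sign n - sign m *ℚ sign n                    ≡⟨ solve 2 (λ s t → t :- s :* t := (con 1ℚ :- s) :* t) refl (sign m) (sign n) ⟩
  (1ℚ - sign m) *ℚ sign n                      ≡⟨ cong (λ s → (1ℚ - s) *ℚ sign n) (sign≡if-odd m) ⟩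
  (1ℚ - (if isOdd m then - 1ℚ else 1ℚ)) *ℚ sign n ≡⟨ cong (_*ℚ sign n) (one-minus (isOdd m)) ⟩
  (if isOdd m then fromℕ 2 else 0ℚ) *ℚ sign n  ∎
  where
  one-minus : ∀ b → 1ℚ - (if b then - 1ℚ else 1ℚ) ≡ (if b then fromℕ 2 else 0ℚ)
  one-minus true  = refl
  one-minus false = refl

p+[m∸k]∸m≡p∸k : ∀ p {k m} → k ≤ m → (p + (m ∸ k)) ∸ m ≡ p ∸ k
p+[m∸k]∸m≡p∸k p {k} {m} k≤m =
  trans (sym (r∸[m∸k]≡r+k∸m p (ℕ.m∸n≤m m k))) (cong (p ∸_) (ℕ.m∸[m∸n]≡n k≤m))

reflectedEulerTerm : ℕ → ℕ → ℕ → ℕ → ℕ → ℕ → ℚ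
reflectedEulerTerm q p r N m k =
  sign (m + k) *ℚ fromℕ (stirling1 (suc q) (suc m)) *ℚ fromℕ (m C k) *ℚ eulerN ((r + k) ∸ m) (p ∸ k) N

q!*hypEulerN≡triangleSum-reflected : ∀ {q p r} → q ≤ p → q ≤ r → ∀ N →
  fromℕ (q !) *ℚ hypEulerN r (suc q) p N ≡ triangleSum q (reflectedEulerTerm q p r N)
q!*hypEulerN≡triangleSum-reflected {q} {p} {r} q≤p q≤r N =
  trans (q!*hypEulerN≡triangleSum q≤r q≤p N)
        (sumUpTo-cong q (λ m _ → trans (sumUpTo-reverse (eulerTerm q r p N m) m) (sumUpTo-cong m (λ k k≤m → reindex k≤m))))
  where
  reindex : ∀ {m k} → k ≤ m → eulerTerm q r p N m (m ∸ k) ≡ reflectedEulerTerm q p r N m k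
  reindex {m} {k} k≤m = begin
    sign (m ∸ k) *ℚ st *ℚ fromℕ (m C (m ∸ k)) *ℚ eulerN (r ∸ (m ∸ k)) ((p + (m ∸ k)) ∸ m) N
      ≡⟨ cong₂ (λ s c → s *ℚ st *ℚ fromℕ c *ℚ eulerN (r ∸ (m ∸ k)) ((p + (m ∸ k)) ∸ m) N)
           (sign-∸ k≤m) (sym (nCk≡nC[n∸k] k≤m)) ⟩
    sign (m + k) *ℚ st *ℚ fromℕ (m C k) *ℚ eulerN (r ∸ (m ∸ k)) ((p + (m ∸ k)) ∸ m) N
      ≡⟨ cong₂ (λ a b → sign (m + k) *ℚ st *ℚ fromℕ (m C k) *ℚ eulerN a b N)
           (r∸[m∸k]≡r+k∸m r k≤m) (p+[m∸k]∸m≡p∸k p k≤m) ⟩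
    reflectedEulerTerm q p r N m k ∎
    where st = fromℕ (stirling1 (suc q) (suc m))

r+k∸m+[p∸k]≡p+r∸m : ∀ {p r k m} → k ≤ p → m ≤ r → (r + k) ∸ m + (p ∸ k) ≡ (p + r) ∸ m
r+k∸m+[p∸k]≡p+r∸m {p} {r} {k} {m} k≤p m≤r = begin
  (r + k) ∸ m + (p ∸ k)        ≡⟨ cong (_+ (p ∸ k)) (ℕ.+-∸-comm k m≤r) ⟩
  r ∸ m + k + (p ∸ k)          ≡⟨ ℕ.+-assoc (r ∸ m) k (p ∸ k) ⟩
  r ∸ m + (k + (p ∸ k))        ≡⟨ cong (λ t → r ∸ m + t) (ℕ.m+[n∸m]≡n k≤p) ⟩
  r ∸ m + p                    ≡⟨ ℕ.+-comm (r ∸ m) p ⟩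
  p + (r ∸ m)                  ≡⟨ sym (ℕ.+-∸-assoc p m≤r) ⟩
  (p + r) ∸ m                  ∎

zetaProductTerm : ℕ → ℕ → ℕ → ℕ → ℕ → ℕ → ℚ
zetaProductTerm q p r N m k =
  sign (m + k) *ℚ fromℕ (stirling1 (suc q) (suc m)) *ℚ fromℕ (m C k) *ℚ (zetaN (p ∸ k) N *ℚ zetaN ((r + k) ∸ m) N)

eulerTerm+reflectedEulerTerm : ∀ {q p r} N {m k} → k ≤ p → m ≤ r →
  eulerTerm q p r N m k +ℚ reflectedEulerTerm q p r N m k
  ≡ (if isOdd m then fromℕ 2 else 0ℚ) *ℚ eulerTerm q p r N m k +ℚ zetaProductTerm q p r N m k
    +ℚ sign (m + k) *ℚ fromℕ (stirling1 (suc q) (suc m)) *ℚ fromℕ (m C k) *ℚ zetaN ((p + r) ∸ m) N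
eulerTerm+reflectedEulerTerm {q} {p} {r} N {m} {k} k≤p m≤r = begin
  s⁺ *ℚ st *ℚ c *ℚ E +ℚ s⁻ *ℚ st *ℚ c *ℚ eulerN b a N
    ≡⟨ cong (λ t → s⁺ *ℚ st *ℚ c *ℚ E +ℚ s⁻ *ℚ st *ℚ c *ℚ t) reflected≡ ⟩
  s⁺ *ℚ st *ℚ c *ℚ E +ℚ s⁻ *ℚ st *ℚ c *ℚ (Za *ℚ Zb +ℚ Z - E)
    ≡⟨ solve 8 (λ x y s c e za zb z → x :* s :* c :* e :+ y :* s :* c :* (za :* zb :+ z :- e)
                                      := (x :- y) :* (s :* c :* e) :+ y :* s :* c :* (za :* zb) :+ y :* s :* c :* z)
         refl s⁺ s⁻ st c E Za Zb Z ⟩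
  (s⁺ - s⁻) *ℚ (st *ℚ c *ℚ E) +ℚ zetaProductTerm q p r N m k +ℚ s⁻ *ℚ st *ℚ c *ℚ Z
    ≡⟨ cong (λ t → t *ℚ (st *ℚ c *ℚ E) +ℚ zetaProductTerm q p r N m k +ℚ s⁻ *ℚ st *ℚ c *ℚ Z) (sign[n]-sign[m+n] m k) ⟩
  π *ℚ s⁺ *ℚ (st *ℚ c *ℚ E) +ℚ zetaProductTerm q p r N m k +ℚ s⁻ *ℚ st *ℚ c *ℚ Z
    ≡⟨ cong (λ t → t +ℚ zetaProductTerm q p r N m k +ℚ s⁻ *ℚ st *ℚ c *ℚ Z)
         (solve 5 (λ x y s c e → x :* y :* (s :* c :* e) := x :* (y :* s :* c :* e)) refl π s⁺ st c E) ⟩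
  π *ℚ eulerTerm q p r N m k +ℚ zetaProductTerm q p r N m k +ℚ s⁻ *ℚ st *ℚ c *ℚ Z ∎
  where
  a = p ∸ k
  b = (r + k) ∸ m
  s⁺ = sign k
  s⁻ = sign (m + k)
  st = fromℕ (stirling1 (suc q) (suc m))
  c = fromℕ (m C k)
  π = if isOdd m then fromℕ 2 else 0ℚ
  E = eulerN a b N
  Za = zetaN a N
  Zb = zetaN b N
  Z = zetaN ((p + r) ∸ m) N
  reflected≡ : eulerN b a N ≡ Za *ℚ Zb +ℚ Z - E
  reflected≡ = begin
    eulerN b a N                         ≡⟨ solve 2 (λ x y → x := x :+ y :- y) refl (eulerN b a N) E ⟩
    eulerN b a N +ℚ E - E                ≡⟨ cong (_- E) (eulerN-reflection b a N) ⟩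
    Zb *ℚ Za +ℚ zetaN (b + a) N - E
      ≡⟨ cong₂ (λ x y → x +ℚ zetaN y N - E) (ℚ.*-comm Zb Za) (r+k∸m+[p∸k]≡p+r∸m k≤p m≤r) ⟩
    Za *ℚ Zb +ℚ Z - E                    ∎

triangleSum-alternating : ∀ q (g : ℕ → ℚ) →
  triangleSum q (λ m k → sign (m + k) *ℚ fromℕ (stirling1 (suc q) (suc m)) *ℚ fromℕ (m C k) *ℚ g m) ≡ fromℕ (q !) *ℚ g 0
triangleSum-alternating q g = begin
  triangleSum q f
    ≡⟨ sumUpTo-head (λ m → sumUpTo (f m) m) q row-vanishes ⟩
  1ℚ *ℚ fromℕ (stirling1 (suc q) 1) *ℚ 1ℚ *ℚ g 0
    ≡⟨ cong (λ s → 1ℚ *ℚ fromℕ s *ℚ 1ℚ *ℚ g 0) (stirling1[1+n,1]≡n! q) ⟩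
  1ℚ *ℚ fromℕ (q !) *ℚ 1ℚ *ℚ g 0
    ≡⟨ solve 2 (λ x y → con 1ℚ :* x :* con 1ℚ :* y := x :* y) refl (fromℕ (q !)) (g 0) ⟩
  fromℕ (q !) *ℚ g 0 ∎
  where
  st : ℕ → ℚ
  st m = fromℕ (stirling1 (suc q) (suc m))
  f : ℕ → ℕ → ℚ
  f m k = sign (m + k) *ℚ st m *ℚ fromℕ (m C k) *ℚ g m
  row-vanishes : ∀ j → sumUpTo (f (suc j)) (suc j) ≡ 0ℚ
  row-vanishes j = begin
    sumUpTo (f m) m
      ≡⟨ sumUpTo-cong m (λ k _ → trans (cong (λ s → s *ℚ st m *ℚ fromℕ (m C k) *ℚ g m) (sign-+ m k))
           (solve 5 (λ x y s c z → x :* y :* s :* c :* z := x :* s :* z :* (y :* c))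
                  refl (sign m) (sign k) (st m) (fromℕ (m C k)) (g m))) ⟩
    sumUpTo (λ k → sign m *ℚ st m *ℚ g m *ℚ (sign k *ℚ fromℕ (m C k))) m
      ≡⟨ sym (*-distribˡ-sumUpTo (sign m *ℚ st m *ℚ g m) _ m) ⟩
    sign m *ℚ st m *ℚ g m *ℚ sumUpTo (λ k → sign k *ℚ fromℕ (m C k)) m
      ≡⟨ cong (sign m *ℚ st m *ℚ g m *ℚ_) (alternating-binomial-sum j) ⟩
    sign m *ℚ st m *ℚ g m *ℚ 0ℚ
      ≡⟨ ℚ.*-zeroʳ (sign m *ℚ st m *ℚ g m) ⟩
    0ℚ ∎
    where m = suc j

triangleSum-odd-rows : ∀ q (f : ℕ → ℕ → ℚ) →
  triangleSum q (λ m k → (if isOdd m then fromℕ 2 else 0ℚ) *ℚ f m k)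
  ≡ fromℕ 2 *ℚ sumUpTo (λ m → if isOdd m then sumUpTo (f m) m else 0ℚ) q
triangleSum-odd-rows q f = begin
  triangleSum q (λ m k → π m *ℚ f m k)
    ≡⟨ sumUpTo-cong q (λ m _ → sym (*-distribˡ-sumUpTo (π m) (f m) m)) ⟩
  sumUpTo (λ m → π m *ℚ sumUpTo (f m) m) q
    ≡⟨ sumUpTo-cong q (λ m _ → if-* (isOdd m) (sumUpTo (f m) m)) ⟩
  sumUpTo (λ m → fromℕ 2 *ℚ (if isOdd m then sumUpTo (f m) m else 0ℚ)) q
    ≡⟨ sym (*-distribˡ-sumUpTo (fromℕ 2) _ q) ⟩
  fromℕ 2 *ℚ sumUpTo (λ m → if isOdd m then sumUpTo (f m) m else 0ℚ) q ∎
  where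
  π : ℕ → ℚ
  π m = if isOdd m then fromℕ 2 else 0ℚ
  if-* : ∀ b x → (if b then fromℕ 2 else 0ℚ) *ℚ x ≡ fromℕ 2 *ℚ (if b then x else 0ℚ)
  if-* true  x = refl
  if-* false x = trans (ℚ.*-zeroˡ x) (sym (ℚ.*-zeroʳ (fromℕ 2)))

oddEulerRows : ℕ → ℕ → ℕ → ℕ → ℚ
oddEulerRows q p r N = sumUpTo (λ m → if isOdd m then sumUpTo (eulerTerm q p r N m) m else 0ℚ) q

q!*lhsN : ∀ {q p r} → q ≤ p → q ≤ r → ∀ N →
  fromℕ (q !) *ℚ lhsN q p r N
  ≡ fromℕ (q !) *ℚ zetaN (p + r) N
    +ℚ fromℕ 2 *ℚ oddEulerRows q p r N +ℚ triangleSum q (zetaProductTerm q p r N)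
q!*lhsN {q} {p} {r} q≤p q≤r N = begin
  F *ℚ (hypEulerN p (suc q) r N +ℚ hypEulerN r (suc q) p N)
    ≡⟨ ℚ.*-distribˡ-+ F (hypEulerN p (suc q) r N) (hypEulerN r (suc q) p N) ⟩
  F *ℚ hypEulerN p (suc q) r N +ℚ F *ℚ hypEulerN r (suc q) p N
    ≡⟨ cong₂ _+ℚ_ (q!*hypEulerN≡triangleSum q≤p q≤r N) (q!*hypEulerN≡triangleSum-reflected q≤p q≤r N) ⟩
  triangleSum q (eulerTerm q p r N) +ℚ triangleSum q (reflectedEulerTerm q p r N)
    ≡⟨ sym (triangleSum-distrib-+ (eulerTerm q p r N) (reflectedEulerTerm q p r N) q) ⟩
  triangleSum q (λ m k → eulerTerm q p r N m k +ℚ reflectedEulerTerm q p r N m k)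
    ≡⟨ triangleSum-cong q (λ m k k≤m m≤q →
         eulerTerm+reflectedEulerTerm {q} N (ℕ.≤-trans k≤m (ℕ.≤-trans m≤q q≤p)) (ℕ.≤-trans m≤q q≤r)) ⟩
  triangleSum q (λ m k → π m *ℚ eulerTerm q p r N m k +ℚ zetaProductTerm q p r N m k +ℚ γ m k)
    ≡⟨ triangleSum-distrib-+ (λ m k → π m *ℚ eulerTerm q p r N m k +ℚ zetaProductTerm q p r N m k) γ q ⟩
  triangleSum q (λ m k → π m *ℚ eulerTerm q p r N m k +ℚ zetaProductTerm q p r N m k) +ℚ triangleSum q γ
    ≡⟨ cong₂ _+ℚ_ (triangleSum-distrib-+ (λ m k → π m *ℚ eulerTerm q p r N m k) (zetaProductTerm q p r N) q)
                  (triangleSum-alternating q (λ m → zetaN ((p + r) ∸ m) N)) ⟩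
  triangleSum q (λ m k → π m *ℚ eulerTerm q p r N m k) +ℚ Y +ℚ F *ℚ zetaN (p + r) N
    ≡⟨ cong (λ t → t +ℚ Y +ℚ F *ℚ zetaN (p + r) N) (triangleSum-odd-rows q (eulerTerm q p r N)) ⟩
  fromℕ 2 *ℚ X +ℚ Y +ℚ F *ℚ zetaN (p + r) N
    ≡⟨ solve 3 (λ x y z → x :+ y :+ z := z :+ x :+ y) refl (fromℕ 2 *ℚ X) Y (F *ℚ zetaN (p + r) N) ⟩
  F *ℚ zetaN (p + r) N +ℚ fromℕ 2 *ℚ X +ℚ Y ∎
  where
  F = fromℕ (q !)
  X = oddEulerRows q p r N
  Y = triangleSum q (zetaProductTerm q p r N)
  π : ℕ → ℚ
  π m = if isOdd m then fromℕ 2 else 0ℚ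
  γ : ℕ → ℕ → ℚ
  γ m k = sign (m + k) *ℚ fromℕ (stirling1 (suc q) (suc m)) *ℚ fromℕ (m C k) *ℚ zetaN ((p + r) ∸ m) N

fromℕ-*-cancelˡ : ∀ n .{{_ : ℕ.NonZero n}} {x y} → fromℕ n *ℚ x ≡ fromℕ n *ℚ y → x ≡ y
fromℕ-*-cancelˡ n {x} {y} n*x≡n*y = begin
  x                        ≡⟨ sym (trans (cong (_*ℚ x) inverse) (ℚ.*-identityˡ x)) ⟩
  (n⁻¹ *ℚ fromℕ n) *ℚ x    ≡⟨ ℚ.*-assoc n⁻¹ (fromℕ n) x ⟩
  n⁻¹ *ℚ (fromℕ n *ℚ x)    ≡⟨ cong (n⁻¹ *ℚ_) n*x≡n*y ⟩
  n⁻¹ *ℚ (fromℕ n *ℚ y)    ≡⟨ sym (ℚ.*-assoc n⁻¹ (fromℕ n) y) ⟩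
  (n⁻¹ *ℚ fromℕ n) *ℚ y    ≡⟨ trans (cong (_*ℚ y) inverse) (ℚ.*-identityˡ y) ⟩
  y                        ∎
  where
  n⁻¹ = (+ 1) / n
  inverse : n⁻¹ *ℚ fromℕ n ≡ 1ℚ
  inverse = trans (ℚ.*-comm n⁻¹ (fromℕ n)) (fromℕ-*-/ n 1)

lhsN≡rhsN : ∀ {q p r} → q ≤ p → q ≤ r → ∀ N → lhsN q p r N ≡ rhsN q p r N
lhsN≡rhsN {q} {p} {r} q≤p q≤r N = fromℕ-*-cancelˡ (q !) {{q !≢0}} (begin
  F *ℚ lhsN q p r N                                       ≡⟨ q!*lhsN q≤p q≤r N ⟩
  F *ℚ Z +ℚ fromℕ 2 *ℚ X +ℚ Y
    ≡⟨ cong₂ (λ a b → F *ℚ Z +ℚ a *ℚ X +ℚ b) (sym (fromℕ-*-/ (q !) {{q !≢0}} 2))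
             (sym (trans (cong (_*ℚ Y) (fromℕ-*-/ (q !) {{q !≢0}} 1)) (ℚ.*-identityˡ Y))) ⟩
  F *ℚ Z +ℚ (F *ℚ two/F) *ℚ X +ℚ (F *ℚ one/F) *ℚ Y
    ≡⟨ solve 6 (λ f z a x b y → f :* z :+ (f :* a) :* x :+ (f :* b) :* y := f :* (z :+ a :* x :+ b :* y)) refl F Z two/F X one/F Y ⟩
  F *ℚ rhsN q p r N                                       ∎)
  where
  F = fromℕ (q !)
  Z = zetaN (p + r) N
  X = oddEulerRows q p r N
  Y = triangleSum q (zetaProductTerm q p r N)
  one/F = ((+ 1) / (q !)) {{q !≢0}}
  two/F = ((+ 2) / (q !)) {{q !≢0}}

≗⇒difference-convergesTo-0 : ∀ {a b : ℕ → ℚ} → (∀ N → a N ≡ b N) → ConvergesTo (λ N → a N - b N) 0ℚ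
≗⇒difference-convergesTo-0 {a} {b} a≗b ε ε>0 = 0 , λ N _ → subst (λ t → ∣ t ∣ <ℚ ε) (sym (difference≡0 N)) ε>0
  where
  difference≡0 : ∀ N → a N - b N - 0ℚ ≡ 0ℚ
  difference≡0 N = trans (cong (λ t → t - b N - 0ℚ) (a≗b N)) (solve 1 (λ x → x :- x :- con 0ℚ := con 0ℚ) refl (b N))

corollary1 : (q p r : ℕ) → suc q < p → suc q < r → 2 ∣ p + r →
    ConvergesTo (λ N → lhsN q p r N - rhsN q p r N) 0ℚ
corollary1 q p r q+1<p q+1<r _ = ≗⇒difference-convergesTo-0 (lhsN≡rhsN (weaken q+1<p) (weaken q+1<r))
  where
  weaken : ∀ {n} → suc q < n → q ≤ n
  weaken q+1<n = ℕ.≤-trans (ℕ.n≤1+n q) (ℕ.<⇒≤ q+1<n)
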